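{- In ${\sf RT}(\mathcal S)$, the object of realizers $S$ is isomorphic to the exponential $\Sigma^N$, where $N$ is the natural numbers object.
   Context: $\mathcal S$ denotes Scott's graph model: the set $\mathcal P(\mathbb N)$ with application $UV=\{n\mid \text{for some } m,\ e_m\subseteq V\text{ and }\langle m,n\rangle\in U\}$, where $e_m=\{k_1,\dots,k_r\}$ iff $m=2^{k_1}+\dots+2^{k_r}$ and $\langle\cdot,\cdot\rangle$ is a fixed bijection $\mathbb N^2\to\mathbb N$. An assembly over $\mathcal S$ is a pair $(X,E_X)$ with $E_X(x)$ a nonempty subset of $\mathcal S$ for each $x\in X$; a morphism $(X,E_X)\to(Y,E_Y)$ is a function $f\colon X\to Y$ for which some $A\in\mathcal S$ satisfies $AV\in E_Y(f(x))$ for all $x$ and $V\in E_X(x)$. Assemblies form a full subcategory of the realizability topos ${\sf RT}(\mathcal S)$. Write $\overline n=\{n\}$. The natural numbers object is the assembly $N=(\mathbb N,E_N)$ with $E_N(n)=\{\overline n\}$. The Sierpinski object is the assembly $\Sigma=(\{0,1\},E_\Sigma)$ with $E_\Sigma(0)=\{\emptyset\}$ and $E_\Sigma(1)=\{\{1\}\}$. The object of realizers is the assembly $S=(\mathcal S,E)$ with $E(U)=\{U\}$. -}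

module Defs where

open import Level using (Level; 0ℓ; _⊔_) renaming (suc to lsuc)
open import Data.Nat using (ℕ; zero; suc; _/_; _%_; _≡ᵇ_)
open import Data.Bool using (Bool; true; false; T)
open import Data.Product using (Σ; ∃; _×_; _,_; proj₁; proj₂)
open import Relation.Unary using (Pred; _⊆_; _∈_; ∅; _≐_; ｛_｝)
open import Relation.Unary.Properties using (≐-refl; ≐-sym; ≐-trans)
open import Relation.Binary.PropositionalEquality using (_≡_)
import Relation.Binary.PropositionalEquality as PE
open import Relation.Binary.Bundles using (Setoid)
open import Function.Bundles using (_⤖_; Bijection)

-- P(ℕ), the carrier of Scott's graph model (subsets as predicates;
-- equality of subsets is extensional equality _≐_).
𝒫ℕ : Set₁
𝒫ℕ = Pred ℕ 0ℓ

𝒫ℕ-setoid : Setoid (lsuc 0ℓ) 0ℓ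
𝒫ℕ-setoid = record
  { Carrier = 𝒫ℕ ; _≈_ = _≐_
  ; isEquivalence = record { refl = ≐-refl ; sym = ≐-sym ; trans = ≐-trans } }

-- e m = the finite set of positions of the 1-bits of m,
-- i.e. e m = {k₁,…,k_r} iff m = 2^k₁ + … + 2^k_r.
e : ℕ → 𝒫ℕ
e m zero    = T ((m % 2) ≡ᵇ 1)
e m (suc k) = e (m / 2) k

‾ : ℕ → 𝒫ℕ
‾ n = ｛ n ｝

module Graph (pair : (ℕ × ℕ) ⤖ ℕ) where

  ⟨_,_⟩ : ℕ → ℕ → ℕ
  ⟨ m , n ⟩ = Bijection.to pair (m , n)

  infixl 9 _·_
  _·_ : 𝒫ℕ → 𝒫ℕ → 𝒫ℕ
  (U · V) n = ∃ λ m → (e m ⊆ V) × (⟨ m , n ⟩ ∈ U)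

  ·-cong : ∀ {U U' V} → U ≐ U' → (U · V) ≐ (U' · V)
  ·-cong (p , q) = (λ { (m , s , u) → m , s , p u }) , (λ { (m , s , u) → m , s , q u })

  -- An assembly: a set X (as a setoid, so that P(ℕ) can carry extensional
  -- equality) with, for each x, a nonempty set E x of realizers (subsets of ℕ);
  -- E x is a set of elements of P(ℕ), hence closed under ≐, and E is a
  -- function of x, hence respects ≈.
  record Assembly (c ℓ r : Level) : Set (lsuc (c ⊔ ℓ ⊔ r)) where
    field
      carrier : Setoid c ℓ
    open Setoid carrier public using (Carrier; _≈_)
    field
      E        : Carrier → 𝒫ℕ → Set r
      E-resp-≈ : ∀ {x y} → x ≈ y → ∀ {V} → E x V → E y V
      E-resp-≐ : ∀ x {V W} → V ≐ W → E x V → E x W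
      nonempty : ∀ x → ∃ λ V → E x V

  module _ {c ℓ r c' ℓ' r'} (X : Assembly c ℓ r) (Y : Assembly c' ℓ' r') where
    private
      module X = Assembly X
      module Y = Assembly Y

    Tracks : 𝒫ℕ → (X.Carrier → Y.Carrier) → Set (c ⊔ lsuc 0ℓ ⊔ r ⊔ r')
    Tracks A f = ∀ x V → X.E x V → Y.E (f x) (A · V)

    record Hom : Set (c ⊔ ℓ ⊔ r ⊔ c' ⊔ ℓ' ⊔ r' ⊔ lsuc 0ℓ) where
      field
        fun     : X.Carrier → Y.Carrier
        cong    : ∀ {x y} → x X.≈ y → fun x Y.≈ fun y
        tracked : ∃ λ A → Tracks A fun
    open Hom public

  _≅_ : ∀ {c ℓ r c' ℓ' r'} → Assembly c ℓ r → Assembly c' ℓ' r' → Set _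
  X ≅ Y = Σ (Hom X Y) λ φ → Σ (Hom Y X) λ ψ →
            (∀ x → fun ψ (fun φ x) X.≈ x) × (∀ y → fun φ (fun ψ y) Y.≈ y)
    where module X = Assembly X
          module Y = Assembly Y

  Exp : ∀ {c ℓ r c' ℓ' r'} (Y : Assembly c' ℓ' r') (X : Assembly c ℓ r) →
        Assembly (c ⊔ ℓ ⊔ r ⊔ c' ⊔ ℓ' ⊔ r' ⊔ lsuc 0ℓ) (c ⊔ ℓ') (c ⊔ r ⊔ r' ⊔ lsuc 0ℓ)
  Exp Y X = record
    { carrier = record
        { Carrier = Hom X Y
        ; _≈_ = λ h k → ∀ x → fun h x Y.≈ fun k x
        ; isEquivalence = record
            { refl  = λ x → Yc.refl
            ; sym   = λ p x → Yc.sym (p x)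
            ; trans = λ p q x → Yc.trans (p x) (q x) } }
    ; E        = λ h A → Tracks X Y A (fun h)
    ; E-resp-≈ = λ p t x V r → Y.E-resp-≈ (p x) (t x V r)
    ; E-resp-≐ = λ h q t x V r → Y.E-resp-≐ (fun h x) (·-cong q) (t x V r)
    ; nonempty = tracked
    }
    where module Y = Assembly Y
          module Yc = Setoid (Assembly.carrier Y)

  N : Assembly 0ℓ 0ℓ 0ℓ
  N = record
    { carrier  = PE.setoid ℕ
    ; E        = λ n V → V ≐ ‾ n
    ; E-resp-≈ = λ { PE.refl p → p }
    ; E-resp-≐ = λ n q p → ≐-trans (≐-sym q) p
    ; nonempty = λ n → ‾ n , ≐-refl }

  ΣΣ-E : Bool → 𝒫ℕ → Set
  ΣΣ-E false V = V ≐ ∅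
  ΣΣ-E true  V = V ≐ ‾ 1

  ΣΣ : Assembly 0ℓ 0ℓ 0ℓ
  ΣΣ = record
    { carrier  = PE.setoid Bool
    ; E        = ΣΣ-E
    ; E-resp-≈ = λ { PE.refl p → p }
    ; E-resp-≐ = λ { false q p → ≐-trans (≐-sym q) p ; true q p → ≐-trans (≐-sym q) p }
    ; nonempty = λ { false → ∅ , ≐-refl ; true → ‾ 1 , ≐-refl } }

  S : Assembly (lsuc 0ℓ) 0ℓ 0ℓ
  S = record
    { carrier  = 𝒫ℕ-setoid
    ; E        = λ U V → V ≐ U
    ; E-resp-≈ = λ p q → ≐-trans q p
    ; E-resp-≐ = λ U q p → ≐-trans (≐-sym q) p
    ; nonempty = λ U → U , ≐-refl }

-- A subset U ⊆ ℕ corresponds to its characteristic map χ U : ℕ → Bool,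
-- which is a morphism N → Σ; conversely h : N → Σ gives {n | h n = 1}.
-- Excluded middle is needed only to define χ.  These two maps are
-- mutually inverse, so it remains to exhibit realizers for both.
--
-- In the graph model the code of a relation between
-- atoms and outputs, `atomic R = {⟨2^j, y⟩ | R j y}`, applies by
-- inspecting single elements of its argument (atomic-·).  From this:
--   A₁ · V · n̄ = {1 | n ∈ V}    (so A₁ tracks U ↦ χ U),
--   A₂ · X     = {n | 1 ∈ X · n̄}  (so A₂ tracks h ↦ {n | h n = 1}).
module Submission where

open import Defs
open import Level using (0ℓ)
open import Data.Nat using (ℕ; zero; suc; _*_; _^_; _/_; _%_; _≡ᵇ_)
open import Data.Nat.Properties using (*-comm)
open import Data.Nat.DivMod using (m*n%n≡0; m*n/n≡m)
open import Data.Product using (_×_; _,_; proj₁; proj₂; ∃)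
open import Data.Bool using (Bool; true; false; T)
open import Data.Bool.Properties using (⇔→≡)
open import Data.Empty using (⊥-elim)
open import Function.Bundles using (_⤖_; Bijection; _⇔_; mk⇔; Equivalence)
import Function.Properties.Equivalence as ⇔
open import Axiom.ExcludedMiddle using (ExcludedMiddle)
open import Relation.Nullary using (Dec; yes; no; ¬_)
open import Relation.Nullary.Decidable using (isYes)
open import Relation.Unary using (_⊆_; _≐_; ∅; ｛_｝)
open import Relation.Unary.Properties using (≐-refl; ≐-sym; ≐-trans)
open import Relation.Binary.PropositionalEquality
open import Relation.Binary.Reasoning.Setoid 𝒫ℕ-setoid

e-zero : ∀ k → ¬ e 0 k
e-zero zero    ()
e-zero (suc k) p = e-zero k p

double-half : ∀ x → 2 * x / 2 ≡ x
double-half x = trans (cong (_/ 2) (*-comm 2 x)) (m*n/n≡m x 2)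

double-even : ∀ x → 2 * x % 2 ≡ 0
double-even x = trans (cong (_% 2) (*-comm 2 x)) (m*n%n≡0 x 2)

-- The binary expansion of 2^j is {j}; this makes 2^j the code of the
-- finite set {j} in the graph model.
e-pow : ∀ j → e (2 ^ j) ≐ ‾ j
e-pow j = only j , has j
  where
    only : ∀ j {k} → e (2 ^ j) k → j ≡ k
    only zero    {zero}  _ = refl
    only zero    {suc k} p = ⊥-elim (e-zero k p)
    only (suc j) {zero}  p =
      ⊥-elim (subst (λ r → T (r ≡ᵇ 1)) (double-even (2 ^ j)) p)
    only (suc j) {suc k} p =
      cong suc (only j (subst (λ m → e m k) (double-half (2 ^ j)) p))

    has : ∀ j {k} → j ≡ k → e (2 ^ j) k
    has zero    refl = _
    has (suc j) refl =
      subst (λ m → e m j) (sym (double-half (2 ^ j))) (has j refl)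

isYes⇔ : ∀ {P : Set} (d : Dec P) → isYes d ≡ true ⇔ P
isYes⇔ (yes p) = mk⇔ (λ _ → p) (λ _ → refl)
isYes⇔ (no ¬p) = mk⇔ (λ ()) (λ p → ⊥-elim (¬p p))

guard : Set → 𝒫ℕ
guard P y = P × 1 ≡ y

guard-cong : ∀ {P Q : Set} → P ⇔ Q → guard P ≐ guard Q
guard-cong P⇔Q = (λ (p , eq) → Equivalence.to P⇔Q p , eq)
               , (λ (q , eq) → Equivalence.from P⇔Q q , eq)

module GraphModel (pair : (ℕ × ℕ) ⤖ ℕ) where
  open Graph pair

  ΣΣ-E⇔guard : ∀ b {X} → ΣΣ-E b X ⇔ (X ≐ guard (b ≡ true))
  ΣΣ-E⇔guard false = mk⇔ (λ X≐ → ≐-trans X≐ (≐-sym empty)) (λ X≐ → ≐-trans X≐ empty)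
    where
      empty : guard (false ≡ true) ≐ ∅
      empty = (λ { (() , _) }) , λ ()
  ΣΣ-E⇔guard true = mk⇔ (λ X≐ → ≐-trans X≐ (≐-sym one)) (λ X≐ → ≐-trans X≐ one)
    where
      one : guard (true ≡ true) ≐ ‾ 1
      one = proj₂ , (λ eq → refl , eq)

  ΣΣ-E-at-1 : ∀ b {X} → ΣΣ-E b X → (X 1 ⇔ b ≡ true)
  ΣΣ-E-at-1 b r = mk⇔ (λ x → proj₁ (proj₁ X≐ x)) (λ t → proj₂ X≐ (t , refl))
    where X≐ = Equivalence.to (ΣΣ-E⇔guard b) r

  ⟨,⟩-injective : ∀ {a b c d} → ⟨ a , b ⟩ ≡ ⟨ c , d ⟩ → (a ≡ c) × (b ≡ d)
  ⟨,⟩-injective eq with Bijection.injective pair eq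
  ... | refl = refl , refl

  ·-congʳ : ∀ U {V V'} → V ≐ V' → U · V ≐ U · V'
  ·-congʳ U (p , q) = (λ (m , s , u) → m , (λ x → p (s x)) , u)
                    , (λ (m , s , u) → m , (λ x → q (s x)) , u)

  -- The code of a relation R from atoms to outputs: it sends the
  -- singleton {j} to every y with R j y.
  atomic : (ℕ → 𝒫ℕ) → 𝒫ℕ
  atomic R x = ∃ λ j → ∃ λ y → R j y × ⟨ 2 ^ j , y ⟩ ≡ x

  atomic-· : ∀ R V → atomic R · V ≐ (λ y → ∃ λ j → V j × R j y)
  atomic-· R V = to , from
    where
      to : atomic R · V ⊆ (λ y → ∃ λ j → V j × R j y)
      to (m , em⊆V , j , y , r , eq) with ⟨,⟩-injective eq
      ... | refl , refl = j , em⊆V (proj₂ (e-pow j) refl) , r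

      from : (λ y → ∃ λ j → V j × R j y) ⊆ atomic R · V
      from (j , v , r) =
        2 ^ j , (λ k∈ → subst V (proj₁ (e-pow j) k∈) v) , j , _ , r , refl

  A₁ : 𝒫ℕ
  A₁ = atomic λ j → ｛ ⟨ 2 ^ j , 1 ⟩ ｝

  A₁-·-· : ∀ V n → A₁ · V · ‾ n ≐ guard (V n)
  A₁-·-· V n = begin
    A₁ · V · ‾ n                           ≈⟨ ·-cong A₁·V≐ ⟩
    atomic (λ j → guard (V j)) · ‾ n       ≈⟨ atomic-· _ (‾ n) ⟩
    (λ y → ∃ λ j → n ≡ j × guard (V j) y)  ≈⟨ (λ { (_ , refl , g) → g }) , (λ g → n , refl , g) ⟩
    guard (V n)                            ∎
    where
      A₁·V≐ : A₁ · V ≐ atomic (λ j → guard (V j))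
      A₁·V≐ = ≐-trans (atomic-· _ V)
        ( (λ { (j , v , refl) → j , 1 , (v , refl) , refl })
        , (λ { (j , _ , (v , refl) , refl) → j , v , refl }) )

  A₂ : 𝒫ℕ
  A₂ = atomic λ j n → ∃ λ m → e m ⊆ ‾ n × ⟨ m , 1 ⟩ ≡ j

  A₂-· : ∀ X → A₂ · X ≐ (λ n → (X · ‾ n) 1)
  A₂-· X = ≐-trans (atomic-· _ X)
    ( (λ { (_ , x , m , em , refl) → m , em , x })
    , (λ (m , em , x) → _ , x , m , em , refl) )

module Isomorphism (lem : ExcludedMiddle 0ℓ) (pair : (ℕ × ℕ) ⤖ ℕ) where
  open Graph pair
  open GraphModel pair

  χ : 𝒫ℕ → ℕ → Bool
  χ U n = isYes (lem {U n})

  χ-spec : ∀ U n → χ U n ≡ true ⇔ U n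
  χ-spec U n = isYes⇔ lem

  χ-cong : ∀ {U U'} → U ≐ U' → ∀ n → χ U n ≡ χ U' n
  χ-cong {U} {U'} (p , q) n =
    ⇔→≡ (⇔.trans (χ-spec U n) (⇔.trans (mk⇔ p q) (⇔.sym (χ-spec U' n))))

  A₁-tracks-χ : ∀ {U V} → V ≐ U → Tracks N ΣΣ (A₁ · V) (χ U)
  A₁-tracks-χ {U} {V} (p , q) n W W≐n = Equivalence.from (ΣΣ-E⇔guard (χ U n)) (begin
    A₁ · V · W            ≈⟨ ·-congʳ (A₁ · V) W≐n ⟩
    A₁ · V · ‾ n          ≈⟨ A₁-·-· V n ⟩
    guard (V n)           ≈⟨ guard-cong (⇔.trans (mk⇔ p q) (⇔.sym (χ-spec U n))) ⟩
    guard (χ U n ≡ true)  ∎)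

  χ-hom : 𝒫ℕ → Hom N ΣΣ
  χ-hom U = record
    { fun = χ U ; cong = λ { refl → refl } ; tracked = A₁ · U , A₁-tracks-χ ≐-refl }

  φ : Hom S (Exp ΣΣ N)
  φ = record { fun = χ-hom ; cong = χ-cong ; tracked = A₁ , λ U V → A₁-tracks-χ }

  support : Hom N ΣΣ → 𝒫ℕ
  support h n = fun h n ≡ true

  A₂-tracks-support : Tracks (Exp ΣΣ N) S A₂ support
  A₂-tracks-support h V V-tracks-h = begin
    A₂ · V                  ≈⟨ A₂-· V ⟩
    (λ n → (V · ‾ n) 1)     ≈⟨ (λ {n} → Equivalence.to (at-1 n)) , (λ {n} → Equivalence.from (at-1 n)) ⟩
    support h               ∎
    where
      at-1 : ∀ n → (V · ‾ n) 1 ⇔ fun h n ≡ true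
      at-1 n = ΣΣ-E-at-1 (fun h n) (V-tracks-h n (‾ n) ≐-refl)

  ψ : Hom (Exp ΣΣ N) S
  ψ = record
    { fun = support
    ; cong = λ h≈k → (λ {n} t → trans (sym (h≈k n)) t) , (λ {n} t → trans (h≈k n) t)
    ; tracked = A₂ , A₂-tracks-support }

  iso : S ≅ Exp ΣΣ N
  iso = φ , ψ
      , (λ U → (λ {n} → Equivalence.to (χ-spec U n)) , (λ {n} → Equivalence.from (χ-spec U n)))
      , (λ h n → ⇔→≡ (χ-spec (support h) n))

proposition3p3 : ExcludedMiddle 0ℓ → (pair : (ℕ × ℕ) ⤖ ℕ) →
    let open Graph pair in S ≅ Exp ΣΣ N
proposition3p3 lem pair = Isomorphism.iso lem pair
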